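{- Let $b\ge2$. The set of all finite products, under convolution $*$, of functions of the forms \[S_{(a;b)}(t),\qquad (I-T^a)\,\delta_{\mathbb{Z}}\!\left(\tfrac{t}{b}\right),\qquad S_b(t),\] where $a$ ranges over positive integers with $\gcd(a,b)=1$, is an abelian group with identity $S_b$. The inverse of $S_{(a;b)}$ in this group is $(I-T^a)\,\delta_{\mathbb{Z}}(t/b)$.
   Context: $\xi_b=e^{2\pi i/b}$; $S_{(a;b)}(n)=\frac1b\sum_{j=1}^{b-1}\frac{\xi_b^{jn}}{1-\xi_b^{ja}}$ and $S_b(n)=\frac1b\sum_{j=1}^{b-1}\xi_b^{jn}$. For $b$-periodic functions $f,g$ on $\mathbb{Z}$, $(f*g)(t)=\sum_{m=0}^{b-1}f(t-m)g(m)$. $\delta_{\mathbb{Z}}(x)=1$ if $x\in\mathbb{Z}$ and $0$ otherwise; $I$ is the identity operator and $(T^ah)(t)=h(t+a)$. -}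

module Defs where

open import Level using (Level; _⊔_) renaming (suc to lsuc)
open import Algebra.Bundles using (CommutativeRing)
open import Data.Nat as ℕ using (ℕ; zero; suc)
open import Data.Nat.Divisibility using (_∣?_)
open import Data.Integer as ℤ using (ℤ; +_; -[1+_]; ∣_∣)
open import Data.Product using (Σ; _,_; proj₁)
open import Data.Bool using (if_then_else_)
open import Relation.Nullary using (¬_)
open import Relation.Nullary.Decidable using (⌊_⌋)
open import Data.Nat.GCD using (gcd)
open import Relation.Binary.PropositionalEquality using (_≡_)

record Field (c ℓ : Level) : Set (lsuc (c ⊔ ℓ)) where
  field
    commutativeRing : CommutativeRing c ℓ
  open CommutativeRing commutativeRing public
  field
    _⁻¹       : Carrier → Carrier
    ⁻¹-inverse : ∀ x → ¬ (x ≈ 0#) → x * (x ⁻¹) ≈ 1#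
    1≉0       : ¬ (1# ≈ 0#)

module Cyc {c ℓ : Level} (F : Field c ℓ) (b : ℕ) (ξ : Field.Carrier F) where
  open Field F

  fromℕ : ℕ → Carrier
  fromℕ zero    = 0#
  fromℕ (suc n) = 1# + fromℕ n

  pow : Carrier → ℕ → Carrier
  pow x zero    = 1#
  pow x (suc n) = x * pow x n

  zpow : Carrier → ℤ → Carrier
  zpow x (+ n)      = pow x n
  zpow x -[1+ n ]   = pow (x ⁻¹) (suc n)

  sumTo : (ℕ → Carrier) → ℕ → Carrier
  sumTo f zero    = 0#
  sumTo f (suc n) = sumTo f n + f n

  sum1 : (ℕ → Carrier) → Carrier
  sum1 f = sumTo (λ k → f (suc k)) (b ℕ.∸ 1)

  binv : Carrier
  binv = (fromℕ b) ⁻¹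

  Sab : ℕ → ℤ → Carrier
  Sab a n = binv * sum1 (λ j → zpow ξ ((+ j) ℤ.* n) * ((1# - pow ξ (j ℕ.* a)) ⁻¹))

  Sb : ℤ → Carrier
  Sb n = binv * sum1 (λ j → zpow ξ ((+ j) ℤ.* n))

  δb : ℤ → Carrier
  δb t = if ⌊ b ∣? ∣ t ∣ ⌋ then 1# else 0#

  T : ℕ → (ℤ → Carrier) → (ℤ → Carrier)
  T a h t = h (t ℤ.+ + a)

  I-T : ℕ → (ℤ → Carrier) → (ℤ → Carrier)
  I-T a h t = h t - T a h t

  Da : ℕ → ℤ → Carrier
  Da a = I-T a δb

  _⊛_ : (ℤ → Carrier) → (ℤ → Carrier) → (ℤ → Carrier)
  (f ⊛ g) t = sumTo (λ m → f (t ℤ.- + m) * g (+ m)) b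

  data Gen : (ℤ → Carrier) → Set c where
    gen-S  : (a : ℕ) → 1 ℕ.≤ a → gcd a b ≡ 1 → Gen (Sab a)
    gen-D  : (a : ℕ) → 1 ℕ.≤ a → gcd a b ≡ 1 → Gen (Da a)
    gen-Sb : Gen Sb

  data InG : (ℤ → Carrier) → Set c where
    gen : ∀ {f} → Gen f → InG f
    mul : ∀ {f g} → InG f → InG g → InG (f ⊛ g)

  G : Set c
  G = Σ (ℤ → Carrier) InG

  _≈G_ : G → G → Set ℓ
  x ≈G y = ∀ t → proj₁ x t ≈ proj₁ y t

  _∙G_ : G → G → G
  (f , p) ∙G (g , q) = (f ⊛ g , mul p q)

  εG : G
  εG = (Sb , gen gen-Sb)

-- Every element f of G is a Fourier multiplier
--   f t = (1/b) Σ_{j=1}^{b-1} ξ^{jt} c_j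
-- for some symbol c.  The symbols of S_b, S_(a;b) and (I − T^a) δ_ℤ(t/b) are 1, 1/(1 − ξ^{ja})
-- and 1 − ξ^{ja} (the last from δ_ℤ(t/b) = (1/b) Σ_{j=0}^{b-1} ξ^{jt}, whose j = 0 term is
-- killed by I − T^a), and by orthogonality of the characters t ↦ ξ^{jt} convolution multiplies
-- symbols.  Since ξ is a primitive b-th root of unity and gcd(a, b) = 1, 1 − ξ^{ja} ≠ 0 for
-- 0 < j < b, so all symbols are invertible: equality, associativity, commutativity, the unit and
-- the inverses in G are then checked on symbols, where they are the laws of the field.

module Submission where

open import Defs
open import Data.Nat as ℕ using (ℕ; zero; suc; _∸_; _≤_; _<_; z≤n; s≤s)
import Data.Nat.Properties as ℕP
open import Data.Nat.GCD using (gcd)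
open import Data.Nat.Coprimality as Coprime using (gcd≡1⇒coprime; coprime-divisor)
open import Data.Nat.Divisibility using (_∣_; _∣?_; ∣⇒≤; divides; n∣m*n; m∣m*n; m%n≡0⇒n∣m)
open import Data.Nat.DivMod using (_%_; _/_; m%n<n; m≡m%n+[m/n]*n)
open import Data.Integer as ℤ using (ℤ; +_; -[1+_])
import Data.Integer.Properties as ℤP
open import Relation.Nullary using (¬_; Dec; yes; no)
open import Relation.Nullary.Decidable using (⌊_⌋)
open import Data.Bool using (if_then_else_)
open import Function using (_∘_)
open import Data.Product using (Σ; _×_; _,_; proj₁; proj₂)
open import Algebra.Definitions using (Identity; Inverse)
open import Algebra.Structures using (IsAbelianGroup)
open import Relation.Binary.Structures using (IsEquivalence)
open import Relation.Binary.Bundles using (Setoid)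
open import Data.Empty using (⊥-elim)
open import Relation.Binary.Definitions using (tri<; tri≈; tri>)
open import Relation.Binary.PropositionalEquality as ≡ using (_≡_; _≢_)

-- Nothing here depends on b or ξ; they are parameters only because Cyc needs them.
module Arithmetic {c ℓ} (F : Field c ℓ) (b : ℕ) (ξ : Field.Carrier F) where
  open Field F
  open Cyc F b ξ
  open import Relation.Binary.Reasoning.Setoid setoid
  open import Algebra.Properties.Ring ring using (x[y-z]≈xy-xz; [y-z]x≈yx-zx)
  open import Algebra.Properties.AbelianGroup +-abelianGroup using (⁻¹-∙-comm; ε⁻¹≈ε)
  open import Algebra.Properties.CommutativeSemigroup +-commutativeSemigroup
    using () renaming (interchange to +-interchange)
  open import Algebra.Properties.CommutativeSemigroup *-commutativeSemigroup
    using (xy∙z≈y∙xz; xy∙z≈x∙zy)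
  open import Algebra.Properties.CommutativeSemiring.Exp commutativeSemiring
    using (_^_; ^-congˡ; ^-homo-*; ^-assocʳ; ^-distrib-*)

  ≡⇒≈ : ∀ {x y} → x ≡ y → x ≈ y
  ≡⇒≈ ≡.refl = refl

  pow≡^ : ∀ x n → pow x n ≡ x ^ n
  pow≡^ x zero    = ≡.refl
  pow≡^ x (suc n) = ≡.cong (x *_) (pow≡^ x n)

  pow-cong : ∀ {x y} n → x ≈ y → pow x n ≈ pow y n
  pow-cong {x} {y} n x≈y rewrite pow≡^ x n | pow≡^ y n = ^-congˡ n x≈y

  pow-homo-* : ∀ x m n → pow x (m ℕ.+ n) ≈ pow x m * pow x n
  pow-homo-* x m n rewrite pow≡^ x (m ℕ.+ n) | pow≡^ x m | pow≡^ x n = ^-homo-* x m n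

  pow-assocʳ : ∀ x m n → pow (pow x m) n ≈ pow x (m ℕ.* n)
  pow-assocʳ x m n rewrite pow≡^ x m | pow≡^ (x ^ m) n | pow≡^ x (m ℕ.* n) = ^-assocʳ x m n

  pow-distrib-* : ∀ x y n → pow (x * y) n ≈ pow x n * pow y n
  pow-distrib-* x y n rewrite pow≡^ (x * y) n | pow≡^ x n | pow≡^ y n = ^-distrib-* x y n

  pow-comm : ∀ x m n → pow (pow x m) n ≈ pow (pow x n) m
  pow-comm x m n = begin
    pow (pow x m) n  ≈⟨ pow-assocʳ x m n ⟩
    pow x (m ℕ.* n)  ≡⟨ ≡.cong (pow x) (ℕP.*-comm m n) ⟩
    pow x (n ℕ.* m)  ≈⟨ pow-assocʳ x n m ⟨
    pow (pow x n) m  ∎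

  pow-1ˡ : ∀ n → pow 1# n ≈ 1#
  pow-1ˡ zero    = refl
  pow-1ˡ (suc n) = trans (*-identityˡ _) (pow-1ˡ n)

  x*y≈1⇒x≉0 : ∀ {x y} → x * y ≈ 1# → ¬ x ≈ 0#
  x*y≈1⇒x≉0 {x} {y} xy≈1 x≈0 = 1≉0 (begin
    1#     ≈⟨ xy≈1 ⟨
    x * y  ≈⟨ *-congʳ x≈0 ⟩
    0# * y ≈⟨ zeroˡ y ⟩
    0#     ∎)

  ⁻¹-inverseˡ : ∀ {x} → ¬ x ≈ 0# → x ⁻¹ * x ≈ 1#
  ⁻¹-inverseˡ {x} x≉0 = trans (*-comm _ _) (⁻¹-inverse x x≉0)

  *-cancelˡ : ∀ {x y z} → ¬ x ≈ 0# → x * y ≈ x * z → y ≈ z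
  *-cancelˡ {x} {y} {z} x≉0 xy≈xz = begin
    y                ≈⟨ *-identityˡ y ⟨
    1# * y           ≈⟨ *-congʳ (⁻¹-inverseˡ x≉0) ⟨
    (x ⁻¹ * x) * y   ≈⟨ *-assoc _ _ _ ⟩
    x ⁻¹ * (x * y)   ≈⟨ *-congˡ xy≈xz ⟩
    x ⁻¹ * (x * z)   ≈⟨ *-assoc _ _ _ ⟨
    (x ⁻¹ * x) * z   ≈⟨ *-congʳ (⁻¹-inverseˡ x≉0) ⟩
    1# * z           ≈⟨ *-identityˡ z ⟩
    z                ∎

  x*y≈0⇒y≈0 : ∀ {x y} → ¬ x ≈ 0# → x * y ≈ 0# → y ≈ 0#
  x*y≈0⇒y≈0 {x} x≉0 xy≈0 = *-cancelˡ x≉0 (trans xy≈0 (sym (zeroʳ x)))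

  1-x≈0⇒x≈1 : ∀ {x} → 1# - x ≈ 0# → x ≈ 1#
  1-x≈0⇒x≈1 {x} 1-x≈0 = begin
    x               ≈⟨ +-identityʳ x ⟨
    x + 0#          ≈⟨ +-congˡ 1-x≈0 ⟨
    x + (1# - x)    ≈⟨ +-comm _ _ ⟩
    (1# - x) + x    ≈⟨ +-assoc _ _ _ ⟩
    1# + (- x + x)  ≈⟨ +-congˡ (-‿inverseˡ x) ⟩
    1# + 0#         ≈⟨ +-identityʳ 1# ⟩
    1#              ∎

  pow-≉0 : ∀ {x} n → ¬ x ≈ 0# → ¬ pow x n ≈ 0#
  pow-≉0 zero    x≉0 = 1≉0
  pow-≉0 (suc n) x≉0 xⁿ⁺¹≈0 = pow-≉0 n x≉0 (x*y≈0⇒y≈0 x≉0 xⁿ⁺¹≈0)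

  pow-*-pow-⁻¹ : ∀ {x} n → ¬ x ≈ 0# → pow x n * pow (x ⁻¹) n ≈ 1#
  pow-*-pow-⁻¹ {x} n x≉0 = begin
    pow x n * pow (x ⁻¹) n  ≈⟨ pow-distrib-* x (x ⁻¹) n ⟨
    pow (x * x ⁻¹) n        ≈⟨ pow-cong n (⁻¹-inverse x x≉0) ⟩
    pow 1# n                ≈⟨ pow-1ˡ n ⟩
    1#                      ∎

  sumTo-cong : ∀ {f g} n → (∀ i → i < n → f i ≈ g i) → sumTo f n ≈ sumTo g n
  sumTo-cong zero    f≈g = refl
  sumTo-cong (suc n) f≈g = +-cong (sumTo-cong n (λ i i<n → f≈g i (ℕP.m≤n⇒m≤1+n i<n))) (f≈g n ℕP.≤-refl)

  sumTo-zero : ∀ {f} n → (∀ i → i < n → f i ≈ 0#) → sumTo f n ≈ 0#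
  sumTo-zero n f≈0 = trans (sumTo-cong n f≈0) (sumTo-0# n)
    where
    sumTo-0# : ∀ n → sumTo (λ _ → 0#) n ≈ 0#
    sumTo-0# zero    = refl
    sumTo-0# (suc n) = trans (+-identityʳ _) (sumTo-0# n)

  sumTo-1# : ∀ n → sumTo (λ _ → 1#) n ≈ fromℕ n
  sumTo-1# zero    = refl
  sumTo-1# (suc n) = trans (+-congʳ (sumTo-1# n)) (+-comm _ _)

  sumTo-head : ∀ f n → sumTo f (suc n) ≈ f 0 + sumTo (λ i → f (suc i)) n
  sumTo-head f zero    = trans (+-identityˡ _) (sym (+-identityʳ _))
  sumTo-head f (suc n) = trans (+-congʳ (sumTo-head f n)) (+-assoc _ _ _)

  sumTo-onlyAt : ∀ {f} n {j} → j < n → (∀ i → i < n → i ≢ j → f i ≈ 0#) → sumTo f n ≈ f j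
  sumTo-onlyAt (suc n) {j} j<1+n f≈0 with j ℕ.≟ n
  ... | yes ≡.refl = trans (+-congʳ (sumTo-zero n (λ i i<n → f≈0 i (ℕP.m≤n⇒m≤1+n i<n) (ℕP.<⇒≢ i<n))))
                           (+-identityˡ _)
  ... | no j≢n     = trans (+-cong (sumTo-onlyAt n (ℕP.≤∧≢⇒< (ℕP.≤-pred j<1+n) j≢n)
                                     (λ i i<n → f≈0 i (ℕP.m≤n⇒m≤1+n i<n)))
                                   (f≈0 n ℕP.≤-refl (j≢n ∘ ≡.sym)))
                           (+-identityʳ _)

  sumTo-distrib-+ : ∀ f g n → sumTo (λ i → f i + g i) n ≈ sumTo f n + sumTo g n
  sumTo-distrib-+ f g zero    = sym (+-identityʳ 0#)
  sumTo-distrib-+ f g (suc n) = trans (+-congʳ (sumTo-distrib-+ f g n)) (+-interchange _ _ _ _)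

  -‿distrib-sumTo : ∀ f n → - sumTo f n ≈ sumTo (λ i → - f i) n
  -‿distrib-sumTo f zero    = ε⁻¹≈ε
  -‿distrib-sumTo f (suc n) = trans (sym (⁻¹-∙-comm _ _)) (+-congʳ (-‿distrib-sumTo f n))

  sumTo-distrib-− : ∀ f g n → sumTo f n - sumTo g n ≈ sumTo (λ i → f i - g i) n
  sumTo-distrib-− f g n = trans (+-congˡ (-‿distrib-sumTo g n)) (sym (sumTo-distrib-+ f (λ i → - g i) n))

  *-distribˡ-sumTo : ∀ x f n → x * sumTo f n ≈ sumTo (λ i → x * f i) n
  *-distribˡ-sumTo x f zero    = zeroʳ x
  *-distribˡ-sumTo x f (suc n) = trans (distribˡ x _ _) (+-congʳ (*-distribˡ-sumTo x f n))

  *-distribʳ-sumTo : ∀ x f n → sumTo f n * x ≈ sumTo (λ i → f i * x) n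
  *-distribʳ-sumTo x f n =
    trans (*-comm _ x) (trans (*-distribˡ-sumTo x f n) (sumTo-cong n (λ i _ → *-comm x (f i))))

  sumTo-*-sumTo : ∀ f g m n → sumTo f m * sumTo g n ≈ sumTo (λ i → sumTo (λ j → f i * g j) n) m
  sumTo-*-sumTo f g m n =
    trans (*-distribʳ-sumTo (sumTo g n) f m) (sumTo-cong m (λ i _ → *-distribˡ-sumTo (f i) g n))

  sumTo-comm : ∀ (f : ℕ → ℕ → Carrier) m n →
               sumTo (λ i → sumTo (f i) m) n ≈ sumTo (λ j → sumTo (λ i → f i j) n) m
  sumTo-comm f m zero    = sym (sumTo-zero m (λ _ _ → refl))
  sumTo-comm f m (suc n) = begin
    sumTo (λ i → sumTo (f i) m) n + sumTo (f n) m                ≈⟨ +-congʳ (sumTo-comm f m n) ⟩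
    sumTo (λ j → sumTo (λ i → f i j) n) m + sumTo (f n) m        ≈⟨ sumTo-distrib-+ _ _ m ⟨
    sumTo (λ j → sumTo (λ i → f i j) n + f n j) m                ∎

  geometric-sum : ∀ w n → (1# - w) * sumTo (pow w) n ≈ 1# - pow w n
  geometric-sum w zero    = trans (zeroʳ _) (sym (-‿inverseʳ 1#))
  geometric-sum w (suc n) = begin
    (1# - w) * (sumTo (pow w) n + pow w n)             ≈⟨ distribˡ _ _ _ ⟩
    (1# - w) * sumTo (pow w) n + (1# - w) * pow w n    ≈⟨ +-cong (geometric-sum w n) ([y-z]x≈yx-zx (pow w n) 1# w) ⟩
    (1# - pow w n) + (1# * pow w n - w * pow w n)      ≈⟨ +-congˡ (+-congʳ (*-identityˡ _)) ⟩
    (1# - pow w n) + (pow w n - w * pow w n)           ≈⟨ +-assoc _ _ _ ⟩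
    1# + (- pow w n + (pow w n - w * pow w n))         ≈⟨ +-congˡ (+-assoc _ _ _) ⟨
    1# + ((- pow w n + pow w n) - w * pow w n)         ≈⟨ +-congˡ (+-congʳ (-‿inverseˡ _)) ⟩
    1# + (0# - w * pow w n)                            ≈⟨ +-congˡ (+-identityˡ _) ⟩
    1# - w * pow w n                                   ∎

  sumTo-pow-≈1 : ∀ {w} n → w ≈ 1# → sumTo (pow w) n ≈ fromℕ n
  sumTo-pow-≈1 n w≈1 = trans (sumTo-cong n (λ i _ → trans (pow-cong i w≈1) (pow-1ˡ i))) (sumTo-1# n)

  sumTo-pow-root : ∀ {w} n → pow w n ≈ 1# → ¬ w ≈ 1# → sumTo (pow w) n ≈ 0#
  sumTo-pow-root {w} n wⁿ≈1 w≉1 = x*y≈0⇒y≈0 (w≉1 ∘ 1-x≈0⇒x≈1) (begin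
    (1# - w) * sumTo (pow w) n  ≈⟨ geometric-sum w n ⟩
    1# - pow w n                ≈⟨ +-congˡ (-‿cong wⁿ≈1) ⟩
    1# - 1#                     ≈⟨ -‿inverseʳ 1# ⟩
    0#                          ∎)

  zpow-neg : ∀ x m → zpow x (ℤ.- + m) ≈ pow (x ⁻¹) m
  zpow-neg x zero    = refl
  zpow-neg x (suc m) = refl

  module _ {x} (x≉0 : ¬ x ≈ 0#) where

    zpow-+1 : ∀ t → zpow x (t ℤ.+ + 1) ≈ zpow x t * x
    zpow-+1 (+ k)      = trans (pow-homo-* x k 1) (*-congˡ (*-identityʳ x))
    zpow-+1 -[1+ k ]   = sym (begin
      (x ⁻¹ * pow (x ⁻¹) k) * x   ≈⟨ xy∙z≈y∙xz _ _ _ ⟩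
      pow (x ⁻¹) k * (x ⁻¹ * x)   ≈⟨ *-congˡ (⁻¹-inverseˡ x≉0) ⟩
      pow (x ⁻¹) k * 1#           ≈⟨ *-identityʳ _ ⟩
      pow (x ⁻¹) k                ≈⟨ ≡⇒≈ (zpow-−[1+k]+1 k) ⟩
      zpow x (-[1+ k ] ℤ.+ + 1)   ∎)
      where
      zpow-−[1+k]+1 : ∀ k → pow (x ⁻¹) k ≡ zpow x (-[1+ k ] ℤ.+ + 1)
      zpow-−[1+k]+1 zero    = ≡.refl
      zpow-−[1+k]+1 (suc k) = ≡.refl

    zpow-−1 : ∀ t → zpow x (t ℤ.+ -[1+ 0 ]) ≈ zpow x t * x ⁻¹
    zpow-−1 (+ zero)   = *-comm _ _
    zpow-−1 (+ suc k)  = sym (begin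
      (x * pow x k) * x ⁻¹   ≈⟨ xy∙z≈y∙xz _ _ _ ⟩
      pow x k * (x * x ⁻¹)   ≈⟨ *-congˡ (⁻¹-inverse x x≉0) ⟩
      pow x k * 1#           ≈⟨ *-identityʳ _ ⟩
      pow x k                ∎)
    zpow-−1 -[1+ k ]   = trans (≡⇒≈ (≡.cong (λ m → pow (x ⁻¹) (suc (suc m))) (ℕP.+-identityʳ k))) (*-comm _ _)

    zpow-homo-+ : ∀ s t → zpow x (s ℤ.+ t) ≈ zpow x s * zpow x t
    zpow-homo-+ s (+ zero)        = trans (≡⇒≈ (≡.cong (zpow x) (ℤP.+-identityʳ s))) (sym (*-identityʳ _))
    zpow-homo-+ s (+ suc m)       = begin
      zpow x (s ℤ.+ + suc m)              ≡⟨ ≡.cong (zpow x) ℤ+suc ⟩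
      zpow x ((s ℤ.+ + m) ℤ.+ + 1)        ≈⟨ zpow-+1 (s ℤ.+ + m) ⟩
      zpow x (s ℤ.+ + m) * x              ≈⟨ *-congʳ (zpow-homo-+ s (+ m)) ⟩
      (zpow x s * pow x m) * x            ≈⟨ xy∙z≈x∙zy _ _ _ ⟩
      zpow x s * pow x (suc m)            ∎
      where
      ℤ+suc : s ℤ.+ + suc m ≡ (s ℤ.+ + m) ℤ.+ + 1
      ℤ+suc = ≡.trans (≡.cong (λ k → s ℤ.+ + k) (ℕP.+-comm 1 m)) (≡.sym (ℤP.+-assoc s (+ m) (+ 1)))
    zpow-homo-+ s -[1+ zero ]     = trans (zpow-−1 s) (*-congˡ (sym (*-identityʳ _)))
    zpow-homo-+ s -[1+ suc m ]    = begin
      zpow x (s ℤ.+ -[1+ suc m ])             ≡⟨ ≡.cong (zpow x) ℤ+pred ⟩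
      zpow x ((s ℤ.+ -[1+ m ]) ℤ.+ -[1+ 0 ])  ≈⟨ zpow-−1 (s ℤ.+ -[1+ m ]) ⟩
      zpow x (s ℤ.+ -[1+ m ]) * x ⁻¹          ≈⟨ *-congʳ (zpow-homo-+ s -[1+ m ]) ⟩
      (zpow x s * pow (x ⁻¹) (suc m)) * x ⁻¹  ≈⟨ xy∙z≈x∙zy _ _ _ ⟩
      zpow x s * pow (x ⁻¹) (suc (suc m))     ∎
      where
      ℤ+pred : s ℤ.+ -[1+ suc m ] ≡ (s ℤ.+ -[1+ m ]) ℤ.+ -[1+ 0 ]
      ℤ+pred = ≡.trans (≡.cong (λ k → s ℤ.+ -[1+ suc k ]) (≡.sym (ℕP.+-identityʳ m)))
                       (≡.sym (ℤP.+-assoc s -[1+ m ] -[1+ 0 ]))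

    zpow-* : ∀ j t → zpow x (+ j ℤ.* t) ≈ pow (zpow x t) j
    zpow-* zero    t = refl
    zpow-* (suc j) t = begin
      zpow x (+ suc j ℤ.* t)           ≡⟨ ≡.cong (zpow x) (ℤP.suc-* (+ j) t) ⟩
      zpow x (t ℤ.+ + j ℤ.* t)         ≈⟨ zpow-homo-+ t (+ j ℤ.* t) ⟩
      zpow x t * zpow x (+ j ℤ.* t)    ≈⟨ *-congˡ (zpow-* j t) ⟩
      zpow x t * pow (zpow x t) j      ∎

module RootOfUnity {c ℓ} (F : Field c ℓ) (N : ℕ) (ξ : Field.Carrier F)
  (ξᵇ≈1 : Field._≈_ F (Cyc.pow F (suc N) ξ ξ (suc N)) (Field.1# F))
  (ξ-primitive : ∀ j → 1 ≤ j → j < suc N → ¬ Field._≈_ F (Cyc.pow F (suc N) ξ ξ j) (Field.1# F))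
  where

  b : ℕ
  b = suc N

  open Field F
  open Cyc F b ξ
  open Arithmetic F b ξ public
  open import Relation.Binary.Reasoning.Setoid setoid

  ξ≉0 : ¬ ξ ≈ 0#
  ξ≉0 = x*y≈1⇒x≉0 ξᵇ≈1

  ξ⁻¹ᵇ≈1 : pow (ξ ⁻¹) b ≈ 1#
  ξ⁻¹ᵇ≈1 = begin
    pow (ξ ⁻¹) b             ≈⟨ *-identityˡ _ ⟨
    1# * pow (ξ ⁻¹) b        ≈⟨ *-congʳ ξᵇ≈1 ⟨
    pow ξ b * pow (ξ ⁻¹) b   ≈⟨ pow-*-pow-⁻¹ b ξ≉0 ⟩
    1#                       ∎

  ∣⇒pow≈1 : ∀ {x} k → pow x b ≈ 1# → b ∣ k → pow x k ≈ 1#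
  ∣⇒pow≈1 {x} _ xᵇ≈1 (divides q ≡.refl) = begin
    pow x (q ℕ.* b)    ≡⟨ ≡.cong (pow x) (ℕP.*-comm q b) ⟩
    pow x (b ℕ.* q)    ≈⟨ pow-assocʳ x b q ⟨
    pow (pow x b) q    ≈⟨ pow-cong q xᵇ≈1 ⟩
    pow 1# q           ≈⟨ pow-1ˡ q ⟩
    1#                 ∎

  pow-distinct : ∀ {i j} → i < j → j < b → ¬ pow ξ i ≈ pow ξ j
  pow-distinct {i} {j} i<j j<b ξⁱ≈ξʲ =
    ξ-primitive (j ∸ i) (ℕP.m<n⇒0<n∸m i<j) (ℕP.≤-<-trans (ℕP.m∸n≤m j i) j<b)
      (sym (*-cancelˡ (pow-≉0 i ξ≉0) (begin
        pow ξ i * 1#              ≈⟨ *-identityʳ _ ⟩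
        pow ξ i                   ≈⟨ ξⁱ≈ξʲ ⟩
        pow ξ j                   ≡⟨ ≡.cong (pow ξ) (ℕP.m+[n∸m]≡n (ℕP.<⇒≤ i<j)) ⟨
        pow ξ (i ℕ.+ (j ∸ i))     ≈⟨ pow-homo-* ξ i (j ∸ i) ⟩
        pow ξ i * pow ξ (j ∸ i)   ∎)))

  pow-injective : ∀ {i j} → i < b → j < b → pow ξ i ≈ pow ξ j → i ≡ j
  pow-injective {i} {j} i<b j<b ξⁱ≈ξʲ with ℕP.<-cmp i j
  ... | tri< i<j _ _ = ⊥-elim (pow-distinct i<j j<b ξⁱ≈ξʲ)
  ... | tri≈ _ i≡j _ = i≡j
  ... | tri> _ _ j<i = ⊥-elim (pow-distinct j<i i<b (sym ξⁱ≈ξʲ))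

  pow≈1⇒∣ : ∀ k → pow ξ k ≈ 1# → b ∣ k
  pow≈1⇒∣ k ξᵏ≈1 = m%n≡0⇒n∣m k b (pow-injective (m%n<n k b) (s≤s z≤n) (begin
    pow ξ (k % b)                             ≈⟨ *-identityʳ _ ⟨
    pow ξ (k % b) * 1#                        ≈⟨ *-congˡ (∣⇒pow≈1 ((k / b) ℕ.* b) ξᵇ≈1 (n∣m*n (k / b))) ⟨
    pow ξ (k % b) * pow ξ ((k / b) ℕ.* b)     ≈⟨ pow-homo-* ξ (k % b) ((k / b) ℕ.* b) ⟨
    pow ξ (k % b ℕ.+ (k / b) ℕ.* b)           ≡⟨ ≡.cong (pow ξ) (m≡m%n+[m/n]*n k b) ⟨
    pow ξ k                                   ≈⟨ ξᵏ≈1 ⟩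
    1#                                        ∎))

  ∣⇒zpow≈1 : ∀ t → b ∣ ℤ.∣ t ∣ → zpow ξ t ≈ 1#
  ∣⇒zpow≈1 (+ k)      b∣k = ∣⇒pow≈1 k ξᵇ≈1 b∣k
  ∣⇒zpow≈1 -[1+ k ]   b∣k = ∣⇒pow≈1 (suc k) ξ⁻¹ᵇ≈1 b∣k

  zpow≈1⇒∣ : ∀ t → zpow ξ t ≈ 1# → b ∣ ℤ.∣ t ∣
  zpow≈1⇒∣ (+ k)      ξᵏ≈1 = pow≈1⇒∣ k ξᵏ≈1
  zpow≈1⇒∣ -[1+ k ]   ξ⁻ᵏ≈1 = pow≈1⇒∣ (suc k) (begin
    pow ξ (suc k)                        ≈⟨ *-identityʳ _ ⟨
    pow ξ (suc k) * 1#                   ≈⟨ *-congˡ ξ⁻ᵏ≈1 ⟨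
    pow ξ (suc k) * pow (ξ ⁻¹) (suc k)   ≈⟨ pow-*-pow-⁻¹ (suc k) ξ≉0 ⟩
    1#                                   ∎)

  pow-zpow-b : ∀ t → pow (zpow ξ t) b ≈ 1#
  pow-zpow-b t = trans (sym (zpow-* ξ≉0 b t))
    (∣⇒zpow≈1 (+ b ℤ.* t) (≡.subst (b ∣_) (≡.sym (ℤP.abs-* (+ b) t)) (m∣m*n ℤ.∣ t ∣)))

  charSum : ℕ → ℕ → Carrier
  charSum k l = sumTo (pow (pow (ξ ⁻¹) k * pow ξ l)) b

  orthogonality-diag : ∀ k → charSum k k ≈ fromℕ b
  orthogonality-diag k = sumTo-pow-≈1 b (trans (*-comm _ _) (pow-*-pow-⁻¹ k ξ≉0))

  orthogonality : ∀ {k l} → k < b → l < b → k ≢ l → charSum k l ≈ 0#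
  orthogonality {k} {l} k<b l<b k≢l = sumTo-pow-root b wᵇ≈1 w≉1
    where
    wᵇ≈1 : pow (pow (ξ ⁻¹) k * pow ξ l) b ≈ 1#
    wᵇ≈1 = begin
      pow (pow (ξ ⁻¹) k * pow ξ l) b             ≈⟨ pow-distrib-* _ _ b ⟩
      pow (pow (ξ ⁻¹) k) b * pow (pow ξ l) b     ≈⟨ *-cong (pow-comm (ξ ⁻¹) k b) (pow-comm ξ l b) ⟩
      pow (pow (ξ ⁻¹) b) k * pow (pow ξ b) l     ≈⟨ *-cong (pow-cong k ξ⁻¹ᵇ≈1) (pow-cong l ξᵇ≈1) ⟩
      pow 1# k * pow 1# l                        ≈⟨ *-cong (pow-1ˡ k) (pow-1ˡ l) ⟩
      1# * 1#                                    ≈⟨ *-identityˡ 1# ⟩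
      1#                                         ∎
    w≉1 : ¬ pow (ξ ⁻¹) k * pow ξ l ≈ 1#
    w≉1 w≈1 = k≢l (pow-injective k<b l<b (begin
      pow ξ k                                  ≈⟨ *-identityʳ _ ⟨
      pow ξ k * 1#                             ≈⟨ *-congˡ w≈1 ⟨
      pow ξ k * (pow (ξ ⁻¹) k * pow ξ l)       ≈⟨ *-assoc _ _ _ ⟨
      (pow ξ k * pow (ξ ⁻¹) k) * pow ξ l       ≈⟨ *-congʳ (pow-*-pow-⁻¹ k ξ≉0) ⟩
      1# * pow ξ l                             ≈⟨ *-identityˡ _ ⟩
      pow ξ l                                  ∎))

module Fourier {c ℓ} (F : Field c ℓ) (N : ℕ) (ξ : Field.Carrier F)
  (ξᵇ≈1 : Field._≈_ F (Cyc.pow F (suc N) ξ ξ (suc N)) (Field.1# F))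
  (ξ-primitive : ∀ j → 1 ≤ j → j < suc N → ¬ Field._≈_ F (Cyc.pow F (suc N) ξ ξ j) (Field.1# F))
  (b≉0 : ¬ Field._≈_ F (Cyc.fromℕ F (suc N) ξ (suc N)) (Field.0# F))
  where

  open Field F
  open RootOfUnity F N ξ ξᵇ≈1 ξ-primitive public
  open Cyc F b ξ
  open import Relation.Binary.Reasoning.Setoid setoid
  open import Algebra.Properties.Ring ring using (x[y-z]≈xy-xz)
  open import Algebra.Properties.CommutativeSemigroup *-commutativeSemigroup
    using (interchange; x∙yz≈xz∙y; xy∙z≈xz∙y)

  χ : ℕ → ℤ → Carrier
  χ k t = zpow ξ (+ k ℤ.* t)

  χ-homo-+ : ∀ k s t → χ k (s ℤ.+ t) ≈ χ k s * χ k t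
  χ-homo-+ k s t = begin
    zpow ξ (+ k ℤ.* (s ℤ.+ t))           ≈⟨ zpow-* ξ≉0 k (s ℤ.+ t) ⟩
    pow (zpow ξ (s ℤ.+ t)) k             ≈⟨ pow-cong k (zpow-homo-+ ξ≉0 s t) ⟩
    pow (zpow ξ s * zpow ξ t) k          ≈⟨ pow-distrib-* _ _ k ⟩
    pow (zpow ξ s) k * pow (zpow ξ t) k  ≈⟨ *-cong (zpow-* ξ≉0 k s) (zpow-* ξ≉0 k t) ⟨
    χ k s * χ k t                        ∎

  χ-pos : ∀ k m → χ k (+ m) ≈ pow (pow ξ k) m
  χ-pos k m = trans (zpow-* ξ≉0 k (+ m)) (pow-comm ξ m k)

  χ-neg : ∀ k m → χ k (ℤ.- + m) ≈ pow (pow (ξ ⁻¹) k) m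
  χ-neg k m = trans (zpow-* ξ≉0 k (ℤ.- + m)) (trans (pow-cong k (zpow-neg ξ m)) (pow-comm (ξ ⁻¹) m k))

  ⊛-cong : ∀ {f f′ g g′} → (∀ t → f t ≈ f′ t) → (∀ t → g t ≈ g′ t) → ∀ t → (f ⊛ g) t ≈ (f′ ⊛ g′) t
  ⊛-cong f≈f′ g≈g′ t = sumTo-cong b (λ m _ → *-cong (f≈f′ (t ℤ.- + m)) (g≈g′ (+ m)))

  ⊛-scale : ∀ x y f g t → ((λ s → x * f s) ⊛ (λ s → y * g s)) t ≈ (x * y) * (f ⊛ g) t
  ⊛-scale x y f g t = trans (sumTo-cong b (λ m _ → interchange _ _ _ _)) (sym (*-distribˡ-sumTo _ _ b))

  ⊛-sumTo : ∀ (f g : ℕ → ℤ → Carrier) K L t →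
            ((λ s → sumTo (λ k → f k s) K) ⊛ (λ s → sumTo (λ l → g l s) L)) t
              ≈ sumTo (λ k → sumTo (λ l → (f k ⊛ g l) t) L) K
  ⊛-sumTo f g K L t = begin
    sumTo (λ m → sumTo (λ k → f k (t ℤ.- + m)) K * sumTo (λ l → g l (+ m)) L) b
      ≈⟨ sumTo-cong b (λ m _ → sumTo-*-sumTo _ _ K L) ⟩
    sumTo (λ m → sumTo (λ k → sumTo (λ l → f k (t ℤ.- + m) * g l (+ m)) L) K) b
      ≈⟨ sumTo-comm _ K b ⟩
    sumTo (λ k → sumTo (λ m → sumTo (λ l → f k (t ℤ.- + m) * g l (+ m)) L) b) K
      ≈⟨ sumTo-cong K (λ k _ → sumTo-comm _ L b) ⟩
    sumTo (λ k → sumTo (λ l → (f k ⊛ g l) t) L) K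
      ∎

  χ-⊛-χ : ∀ k l t → (χ k ⊛ χ l) t ≈ χ k t * charSum k l
  χ-⊛-χ k l t = trans (sumTo-cong b (λ m _ → term m)) (sym (*-distribˡ-sumTo _ _ b))
    where
    term : ∀ m → χ k (t ℤ.- + m) * χ l (+ m) ≈ χ k t * pow (pow (ξ ⁻¹) k * pow ξ l) m
    term m = begin
      χ k (t ℤ.- + m) * χ l (+ m)                            ≈⟨ *-cong (χ-homo-+ k t (ℤ.- + m)) (χ-pos l m) ⟩
      (χ k t * χ k (ℤ.- + m)) * pow (pow ξ l) m              ≈⟨ *-congʳ (*-congˡ (χ-neg k m)) ⟩
      (χ k t * pow (pow (ξ ⁻¹) k) m) * pow (pow ξ l) m       ≈⟨ *-assoc _ _ _ ⟩
      χ k t * (pow (pow (ξ ⁻¹) k) m * pow (pow ξ l) m)       ≈⟨ *-congˡ (pow-distrib-* _ _ m) ⟨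
      χ k t * pow (pow (ξ ⁻¹) k * pow ξ l) m                 ∎

  -- the multiplier with symbol c, written so that Sab a is definitionally one of them
  fourier : (ℕ → Carrier) → ℤ → Carrier
  fourier c t = binv * sum1 (λ j → χ j t * c j)

  fourier-cong : ∀ c d → (∀ k → k < N → c (suc k) ≈ d (suc k)) → ∀ t → fourier c t ≈ fourier d t
  fourier-cong c d c≈d t = *-congˡ (sumTo-cong N (λ k k<N → *-congˡ (c≈d k k<N)))

  fourier-as-sum : ∀ c t → fourier c t ≈ sumTo (λ k → (binv * c (suc k)) * χ (suc k) t) N
  fourier-as-sum c t = trans (*-distribˡ-sumTo binv _ N) (sumTo-cong N (λ k _ → x∙yz≈xz∙y _ _ _))

  b*binv≈1 : fromℕ b * binv ≈ 1#
  b*binv≈1 = ⁻¹-inverse (fromℕ b) b≉0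

  fourier-⊛ : ∀ c d t → (fourier c ⊛ fourier d) t ≈ fourier (λ j → c j * d j) t
  fourier-⊛ c d t = begin
    (fourier c ⊛ fourier d) t
      ≈⟨ ⊛-cong (fourier-as-sum c) (fourier-as-sum d) t ⟩
    ((λ s → sumTo (λ k → x k * e k s) N) ⊛ (λ s → sumTo (λ l → y l * e l s) N)) t
      ≈⟨ ⊛-sumTo (λ k s → x k * e k s) (λ l s → y l * e l s) N N t ⟩
    sumTo (λ k → sumTo (λ l → ((λ s → x k * e k s) ⊛ (λ s → y l * e l s)) t) N) N
      ≈⟨ sumTo-cong N (λ k _ → sumTo-cong N (λ l _ → ⊛-scale (x k) (y l) (e k) (e l) t)) ⟩
    sumTo (λ k → sumTo (λ l → (x k * y l) * (e k ⊛ e l) t) N) N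
      ≈⟨ sumTo-cong N (λ k k<N → sumTo-onlyAt N k<N (off-diagonal k<N)) ⟩
    sumTo (λ k → (x k * y k) * (e k ⊛ e k) t) N
      ≈⟨ sumTo-cong N (λ k _ → diagonal k) ⟩
    sumTo (λ k → (binv * (c (suc k) * d (suc k))) * e k t) N
      ≈⟨ fourier-as-sum (λ j → c j * d j) t ⟨
    fourier (λ j → c j * d j) t
      ∎
    where
    e : ℕ → ℤ → Carrier
    e k = χ (suc k)
    x y : ℕ → Carrier
    x k = binv * c (suc k)
    y l = binv * d (suc l)

    off-diagonal : ∀ {k} → k < N → ∀ l → l < N → l ≢ k → (x k * y l) * (e k ⊛ e l) t ≈ 0#
    off-diagonal {k} k<N l l<N l≢k = begin
      (x k * y l) * (e k ⊛ e l) t                       ≈⟨ *-congˡ (χ-⊛-χ (suc k) (suc l) t) ⟩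
      (x k * y l) * (e k t * charSum (suc k) (suc l))   ≈⟨ *-congˡ (*-congˡ (orthogonality (s≤s k<N) (s≤s l<N) k+1≢l+1)) ⟩
      (x k * y l) * (e k t * 0#)                        ≈⟨ trans (*-congˡ (zeroʳ _)) (zeroʳ _) ⟩
      0#                                                ∎
      where
      k+1≢l+1 : suc k ≢ suc l
      k+1≢l+1 = l≢k ∘ ≡.sym ∘ ℕP.suc-injective

    diagonal : ∀ k → (x k * y k) * (e k ⊛ e k) t ≈ (binv * (c (suc k) * d (suc k))) * e k t
    diagonal k = begin
      (x k * y k) * (e k ⊛ e k) t                        ≈⟨ *-cong (interchange _ _ _ _) (χ-⊛-χ (suc k) (suc k) t) ⟩
      ((binv * binv) * cd) * (e k t * charSum (suc k) (suc k)) ≈⟨ *-congˡ (*-congˡ (orthogonality-diag (suc k))) ⟩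
      ((binv * binv) * cd) * (e k t * fromℕ b)           ≈⟨ *-congʳ (xy∙z≈xz∙y _ _ _) ⟩
      ((binv * cd) * binv) * (e k t * fromℕ b)           ≈⟨ interchange _ _ _ _ ⟩
      ((binv * cd) * e k t) * (binv * fromℕ b)           ≈⟨ *-congˡ (trans (*-comm _ _) b*binv≈1) ⟩
      ((binv * cd) * e k t) * 1#                         ≈⟨ *-identityʳ _ ⟩
      (binv * cd) * e k t                                ∎
      where
      cd = c (suc k) * d (suc k)

  δb-expansion : ∀ t → δb t ≈ binv * sumTo (λ j → χ j t) b
  δb-expansion t = trans (δb≈ (b ∣? ℤ.∣ t ∣)) (*-congˡ (sumTo-cong b (λ j _ → sym (zpow-* ξ≉0 j t))))
    where
    δb≈ : (d : Dec (b ∣ ℤ.∣ t ∣)) → (if ⌊ d ⌋ then 1# else 0#) ≈ binv * sumTo (pow (zpow ξ t)) b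
    δb≈ (yes b∣t) = sym (begin
      binv * sumTo (pow (zpow ξ t)) b   ≈⟨ *-congˡ (sumTo-pow-≈1 b (∣⇒zpow≈1 t b∣t)) ⟩
      binv * fromℕ b                    ≈⟨ trans (*-comm _ _) b*binv≈1 ⟩
      1#                                ∎)
    δb≈ (no b∤t) = sym (begin
      binv * sumTo (pow (zpow ξ t)) b   ≈⟨ *-congˡ (sumTo-pow-root b (pow-zpow-b t) (b∤t ∘ zpow≈1⇒∣ t)) ⟩
      binv * 0#                         ≈⟨ zeroʳ binv ⟩
      0#                                ∎)

  Sb-fourier : ∀ t → Sb t ≈ fourier (λ _ → 1#) t
  Sb-fourier t = *-congˡ (sumTo-cong N (λ k _ → sym (*-identityʳ _)))

  symbolᴰ : ℕ → ℕ → Carrier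
  symbolᴰ a j = 1# - pow ξ (j ℕ.* a)

  Da-fourier : ∀ a t → Da a t ≈ fourier (symbolᴰ a) t
  Da-fourier a t = begin
    δb t - δb (t ℤ.+ + a)
      ≈⟨ +-cong (δb-expansion t) (-‿cong (δb-expansion (t ℤ.+ + a))) ⟩
    binv * sumTo (λ j → χ j t) b - binv * sumTo (λ j → χ j (t ℤ.+ + a)) b
      ≈⟨ x[y-z]≈xy-xz binv _ _ ⟨
    binv * (sumTo (λ j → χ j t) b - sumTo (λ j → χ j (t ℤ.+ + a)) b)
      ≈⟨ *-congˡ (sumTo-distrib-− _ _ b) ⟩
    binv * sumTo (λ j → χ j t - χ j (t ℤ.+ + a)) b
      ≈⟨ *-congˡ (sumTo-cong b (λ j _ → shift j)) ⟩
    binv * sumTo (λ j → χ j t * symbolᴰ a j) b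
      ≈⟨ *-congˡ (sumTo-head _ N) ⟩
    binv * (χ 0 t * (1# - 1#) + sum1 (λ j → χ j t * symbolᴰ a j))
      ≈⟨ *-congˡ (trans (+-congʳ (trans (*-congˡ (-‿inverseʳ 1#)) (zeroʳ _))) (+-identityˡ _)) ⟩
    fourier (symbolᴰ a) t
      ∎
    where
    shift : ∀ j → χ j t - χ j (t ℤ.+ + a) ≈ χ j t * symbolᴰ a j
    shift j = begin
      χ j t - χ j (t ℤ.+ + a)                 ≈⟨ +-congˡ (-‿cong (χ-homo-+ j t (+ a))) ⟩
      χ j t - χ j t * χ j (+ a)               ≈⟨ +-congˡ (-‿cong (*-congˡ (trans (χ-pos j a) (pow-assocʳ ξ j a)))) ⟩
      χ j t - χ j t * pow ξ (j ℕ.* a)         ≈⟨ +-congʳ (*-identityʳ _) ⟨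
      χ j t * 1# - χ j t * pow ξ (j ℕ.* a)    ≈⟨ x[y-z]≈xy-xz _ _ _ ⟨
      χ j t * symbolᴰ a j                     ∎

  symbolᴰ≉0 : ∀ a → gcd a b ≡ 1 → ∀ k → k < N → ¬ symbolᴰ a (suc k) ≈ 0#
  symbolᴰ≉0 a gcd≡1 k k<N 1-ξᵏᵃ≈0 = ℕP.<⇒≱ (s≤s k<N) (∣⇒≤ b∣k+1)
    where
    b∣k+1 : b ∣ suc k
    b∣k+1 = coprime-divisor (Coprime.sym {a} {b} (gcd≡1⇒coprime {a} {b} gcd≡1))
              (≡.subst (b ∣_) (ℕP.*-comm (suc k) a) (pow≈1⇒∣ (suc k ℕ.* a) (1-x≈0⇒x≈1 1-ξᵏᵃ≈0)))

module GeneratedGroup {c ℓ} (F : Field c ℓ) (N : ℕ) (ξ : Field.Carrier F)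
  (ξᵇ≈1 : Field._≈_ F (Cyc.pow F (suc N) ξ ξ (suc N)) (Field.1# F))
  (ξ-primitive : ∀ j → 1 ≤ j → j < suc N → ¬ Field._≈_ F (Cyc.pow F (suc N) ξ ξ j) (Field.1# F))
  (b≉0 : ¬ Field._≈_ F (Cyc.fromℕ F (suc N) ξ (suc N)) (Field.0# F))
  where

  open Field F
  open Fourier F N ξ ξᵇ≈1 ξ-primitive b≉0
  open Cyc F b ξ
  open import Algebra.Properties.CommutativeSemigroup *-commutativeSemigroup using (interchange)

  symbol : ∀ {f} → InG f → ℕ → Carrier
  symbol (gen (gen-S a _ _)) j = symbolᴰ a j ⁻¹
  symbol (gen (gen-D a _ _)) j = symbolᴰ a j
  symbol (gen gen-Sb)        j = 1#
  symbol (mul p q)           j = symbol p j * symbol q j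

  InG⇒fourier : ∀ {f} (p : InG f) t → f t ≈ fourier (symbol p) t
  InG⇒fourier (gen (gen-S a _ _)) t = refl
  InG⇒fourier (gen (gen-D a _ _)) t = Da-fourier a t
  InG⇒fourier (gen gen-Sb)        t = Sb-fourier t
  InG⇒fourier (mul p q)           t =
    trans (⊛-cong (InG⇒fourier p) (InG⇒fourier q) t) (fourier-⊛ (symbol p) (symbol q) t)

  inverse : ∀ {f} → InG f → G
  inverse (gen (gen-S a 1≤a gcd≡1)) = Da a , gen (gen-D a 1≤a gcd≡1)
  inverse (gen (gen-D a 1≤a gcd≡1)) = Sab a , gen (gen-S a 1≤a gcd≡1)
  inverse (gen gen-Sb)              = εG
  inverse (mul p q)                 = inverse p ∙G inverse q

  symbol-inverse : ∀ {f} (p : InG f) k → k < N → symbol p (suc k) * symbol (proj₂ (inverse p)) (suc k) ≈ 1#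
  symbol-inverse (gen (gen-S a _ gcd≡1)) k k<N = ⁻¹-inverseˡ (symbolᴰ≉0 a gcd≡1 k k<N)
  symbol-inverse (gen (gen-D a _ gcd≡1)) k k<N = ⁻¹-inverse _ (symbolᴰ≉0 a gcd≡1 k k<N)
  symbol-inverse (gen gen-Sb)            k k<N = *-identityˡ 1#
  symbol-inverse (mul p q)               k k<N = begin
    (symbol p (suc k) * symbol q (suc k)) * (symbol p′ (suc k) * symbol q′ (suc k))
      ≈⟨ interchange _ _ _ _ ⟩
    (symbol p (suc k) * symbol p′ (suc k)) * (symbol q (suc k) * symbol q′ (suc k))
      ≈⟨ *-cong (symbol-inverse p k k<N) (symbol-inverse q k k<N) ⟩
    1# * 1#
      ≈⟨ *-identityˡ 1# ⟩
    1# ∎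
    where
    open import Relation.Binary.Reasoning.Setoid setoid
    p′ = proj₂ (inverse p)
    q′ = proj₂ (inverse q)

  ≈G-bySymbol : ∀ (x y : G) → (∀ k → k < N → symbol (proj₂ x) (suc k) ≈ symbol (proj₂ y) (suc k)) → x ≈G y
  ≈G-bySymbol (f , p) (g , q) p≈q t =
    trans (InG⇒fourier p t) (trans (fourier-cong (symbol p) (symbol q) p≈q t) (sym (InG⇒fourier q t)))

  inv : G → G
  inv (_ , p) = inverse p

  ≈G-isEquivalence : IsEquivalence _≈G_
  ≈G-isEquivalence = record
    { refl  = λ _ → refl
    ; sym   = λ x≈y t → sym (x≈y t)
    ; trans = λ x≈y y≈z t → trans (x≈y t) (y≈z t)
    }

  G-setoid : Setoid c ℓ
  G-setoid = record { isEquivalence = ≈G-isEquivalence }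

  open import Algebra.Consequences.Setoid G-setoid
    using (comm∧idˡ⇒id; comm∧invʳ⇒inv; assoc∧id∧invʳ⇒invˡ-unique)

  ∙G-cong : ∀ {x y u v} → x ≈G y → u ≈G v → (x ∙G u) ≈G (y ∙G v)
  ∙G-cong x≈y u≈v = ⊛-cong x≈y u≈v

  ∙G-assoc : ∀ x y z → ((x ∙G y) ∙G z) ≈G (x ∙G (y ∙G z))
  ∙G-assoc x y z = ≈G-bySymbol ((x ∙G y) ∙G z) (x ∙G (y ∙G z)) (λ _ _ → *-assoc _ _ _)

  ∙G-comm : ∀ x y → (x ∙G y) ≈G (y ∙G x)
  ∙G-comm x y = ≈G-bySymbol (x ∙G y) (y ∙G x) (λ _ _ → *-comm _ _)

  ∙G-identityˡ : ∀ x → (εG ∙G x) ≈G x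
  ∙G-identityˡ x = ≈G-bySymbol (εG ∙G x) x (λ _ _ → *-identityˡ _)

  ∙G-inverseʳ : ∀ x → (x ∙G inv x) ≈G εG
  ∙G-inverseʳ (f , p) = ≈G-bySymbol ((f , p) ∙G inverse p) εG (symbol-inverse p)

  ∙G-identity : Identity _≈G_ εG _∙G_
  ∙G-identity = comm∧idˡ⇒id {_∙G_} ∙G-comm {εG} ∙G-identityˡ

  ∙G-inverse : Inverse _≈G_ εG inv _∙G_
  ∙G-inverse = comm∧invʳ⇒inv {_∙G_} {inv} {εG} ∙G-comm ∙G-inverseʳ

  inv-cong : ∀ {x y} → x ≈G y → inv x ≈G inv y
  inv-cong {x} {y} x≈y =
    assoc∧id∧invʳ⇒invˡ-unique {_∙G_} {inv} {εG} (λ {x} {y} {u} {v} → ∙G-cong {x} {y} {u} {v})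
      ∙G-assoc ∙G-identity ∙G-inverseʳ (inv x) y
      (λ t → trans (⊛-cong {proj₁ (inv x)} {proj₁ (inv x)} {proj₁ y} {proj₁ x} (λ _ → refl) (λ s → sym (x≈y s)) t)
                   (proj₁ ∙G-inverse x t))

  isAbelianGroup : IsAbelianGroup _≈G_ _∙G_ εG inv
  isAbelianGroup = record
    { isGroup = record
      { isMonoid = record
        { isSemigroup = record
          { isMagma  = record
            { isEquivalence = ≈G-isEquivalence
            ; ∙-cong        = λ {x} {y} {u} {v} → ∙G-cong {x} {y} {u} {v}
            }
          ; assoc    = ∙G-assoc
          }
        ; identity = ∙G-identity
        }
      ; inverse = ∙G-inverse
      ; ⁻¹-cong = λ {x} {y} → inv-cong {x} {y}
      }
    ; comm = ∙G-comm
    }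

theorem6 : ∀ {c ℓ} (F : Field c ℓ) (b : ℕ) (ξ : Field.Carrier F) →
    2 ≤ b →
    Field._≈_ F (Cyc.pow F b ξ ξ b) (Field.1# F) →
    (∀ j → 1 ≤ j → j < b → ¬ Field._≈_ F (Cyc.pow F b ξ ξ j) (Field.1# F)) →
    ¬ Field._≈_ F (Cyc.fromℕ F b ξ b) (Field.0# F) →
    Σ (Cyc.G F b ξ → Cyc.G F b ξ) (λ inv →
      IsAbelianGroup (Cyc._≈G_ F b ξ) (Cyc._∙G_ F b ξ) (Cyc.εG F b ξ) inv
      × (∀ (a : ℕ) (ha : 1 ≤ a) (hg : gcd a b ≡ 1) →
           Cyc._≈G_ F b ξ (inv (Cyc.Sab F b ξ a , Cyc.gen (Cyc.gen-S a ha hg)))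
                          (Cyc.Da F b ξ a , Cyc.gen (Cyc.gen-D a ha hg))))
-- Everything above holds for b ≥ 1; the hypothesis 2 ≤ b is only used to exclude b = 0.
theorem6 F zero    ξ () _ _ _
theorem6 F (suc N) ξ _ ξᵇ≈1 ξ-primitive b≉0 = inv , isAbelianGroup , λ _ _ _ _ → Field.refl F
  where open GeneratedGroup F N ξ ξᵇ≈1 ξ-primitive b≉0
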